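{- Let $n\geq 3$ and $2\leq k\leq n-1$. The number of permutations $\pi\in\mathcal{S}_n$ such that $\pi^2$ has exactly one descent and that descent has size $k$ equals $(n-k)\,b_k\,e_{n-k-1}$.
   Context: $\mathcal{S}_n$ is the symmetric group on $[n]$; a permutation $\sigma=\sigma_1\cdots\sigma_n$ (one-line notation) has a descent at position $i\in[n-1]$ if $\sigma_i>\sigma_{i+1}$, and the size of this descent is $\sigma_i-\sigma_{i+1}$. $\pi^2(j)=\pi(\pi(j))$. $e_j$ is the number of involutions (permutations $\tau$ with $\tau^2=\mathrm{id}$) in $\mathcal{S}_j$, with $e_0=1$. For $k\geq 1$, $\mathcal{A}_k\subset\mathcal{S}_{k+1}$ is the set of permutations with exactly one descent whose size is $k$ (equivalently, $k+1$ is immediately followed by $1$ and there are no other descents), $\mathcal{B}_k=\{\beta\in\mathcal{S}_{k+1}:\beta^2\in\mathcal{A}_k\}$, and $b_k=|\mathcal{B}_k|$. -}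

module Defs where

open import Data.Nat using (ℕ; zero; suc; _+_; _∸_; _<ᵇ_; _≡ᵇ_)
open import Data.Bool using (Bool; true; false; _∧_; _∨_; not)
open import Data.Fin using (Fin; toℕ; fromℕ<)
open import Data.Fin.Properties using (_≟_)
open import Data.List using (List; []; _∷_; map; concatMap; filter; length; allFin)
open import Data.Bool.ListAction using (and)
open import Data.Vec.Functional using (Vector)
open import Relation.Nullary.Decidable using (⌊_⌋)
open import Relation.Binary.PropositionalEquality using (_≡_)
open import Function using (_∘_)

-- A word of length n over [n] in one-line notation: w(i) is the (i+1)-st letter.
Word : ℕ → Set
Word n = Fin n → Fin n

allWords′ : (m n : ℕ) → List (Fin m → Fin n)
allWords′ zero n = (λ ()) ∷ []
allWords′ (suc m) n =
  concatMap (λ x → map (λ w → λ { Fin.zero → x ; (Fin.suc i) → w i }) (allWords′ m n)) (allFin n)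

allWords : (n : ℕ) → List (Word n)
allWords n = allWords′ n n

_≡ᶠ_ : ∀ {n} → Fin n → Fin n → Bool
i ≡ᶠ j = ⌊ i ≟ j ⌋

-- w is a permutation (injective, hence bijective on the finite set [n])
isPerm : ∀ {n} → Word n → Bool
isPerm {n} w = and (map (λ i → and (map (λ j → not (w i ≡ᶠ w j) ∨ (i ≡ᶠ j)) (allFin n))) (allFin n))

square : ∀ {n} → Word n → Word n
square w = w ∘ w

oneLine : ∀ {n} → Word n → List ℕ
oneLine {n} w = map (λ i → toℕ (w i)) (allFin n)

descentSizesL : List ℕ → List ℕ
descentSizesL [] = []
descentSizesL (x ∷ []) = []
descentSizesL (x ∷ y ∷ ys) = step (y <ᵇ x) (descentSizesL (y ∷ ys))
  where
  step : Bool → List ℕ → List ℕ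
  step true ds = (x ∸ y) ∷ ds
  step false ds = ds

descentSizes : (n : ℕ) → Word n → List ℕ
descentSizes n w = descentSizesL (oneLine w)

oneDescentOfSize : ∀ {n} → ℕ → Word n → Bool
oneDescentOfSize {n} k w with descentSizes n w
... | d ∷ [] = d ≡ᵇ k
... | _ = false

countPerms : (n : ℕ) → (Word n → Bool) → ℕ
countPerms n P = length (filter (λ w → (isPerm w ∧ P w) Data.Bool.≟ true) (allWords n))
  where import Data.Bool

e : ℕ → ℕ
e j = countPerms j (λ τ → and (map (λ i → square τ i ≡ᶠ i) (allFin j)))

b : ℕ → ℕ
b k = countPerms (suc k) (λ β → oneDescentOfSize k (square β))

-- Let s = π² have its single descent at p, of size k, and put x = s (p + 1).  Both runs of s
-- increase, the second starts at x and the first ends at x + k; with bijectivity this forces s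
-- to fix every point outside the block [x, x + k] and none inside it.  As π commutes with s, π
-- maps the block onto itself and its complement onto itself.  On the block π is a shifted
-- β ∈ B_k; on the complement π² is the identity, so there π is an involution of the remaining
-- n - k - 1 points.  Conversely every x ≤ n - k - 1, β ∈ B_k and involution τ glue to such a π,
-- and cutting π again recovers (x, β, τ).
module Submission where

open import Level using (Level; _⊔_; 0ℓ)
open import Data.Bool using (Bool; true; false; T; not; _∧_; _∨_)
import Data.Bool as Bool
open import Data.Bool.ListAction using (and)
open import Data.Bool.Properties using (T-∧; T-≡)
open import Data.Fin as Fin using (Fin; toℕ; fromℕ<; punchOut)
open import Data.Fin.Properties as Finₚ
  using (injective⇒≤; toℕ<n; toℕ-injective; toℕ-fromℕ<; any?; punchOut-injective)
open import Data.List
  using (List; []; _∷_; map; concatMap; filter; length; allFin; upTo; lookup; tabulate;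
         cartesianProduct; cartesianProductWith; _++_)
open import Data.List.Properties
  using (∷-injectiveˡ; ∷-injectiveʳ; length-++; length-map; length-upTo; length-tabulate;
         map-tabulate; map-cong)
open import Data.List.Relation.Unary.All as All using (All; []; _∷_)
open import Data.List.Relation.Unary.All.Properties
  using (all-filter; all-upTo; cartesianProduct⁺; all⁺; all⁻; tabulate⁺)
open import Data.List.Relation.Unary.AllPairs using ([]; _∷_)
open import Data.List.Relation.Unary.Any using (here)
open import Data.List.Relation.Unary.Unique.Setoid using (Unique)
import Data.List.Relation.Unary.Unique.Setoid.Properties as Unique
import Data.List.Relation.Unary.Unique.Propositional.Properties as Uniqueₚ
import Data.List.Membership.Setoid as Membership
open import Data.List.Membership.Setoid.Properties
  using (index-injective; ∈-filter⁺; ∈-cartesianProduct⁺; ∈-cartesianProductWith⁺; ∈-resp-≈)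
import Data.List.Membership.Propositional.Properties as Membershipₚ
open import Data.Nat
  using (ℕ; zero; suc; _+_; _*_; _∸_; _≤_; _<_; _≤′_; ≤′-refl; ≤′-step; _<ᵇ_; z≤n; s≤s; z<s)
open import Data.Nat.Induction using (<-rec)
open import Data.Nat.Properties
open import Data.Product as Product using (∃-syntax; _×_; _,_; proj₁; proj₂)
open import Data.Product.Relation.Binary.Pointwise.NonDependent using (_×ₛ_)
open import Data.Sum as Sum using (_⊎_; inj₁; inj₂)
open import Data.Unit using (tt)
open import Function using (_∘_; Congruent; Injective; _⇔_; mk⇔; Equivalence)
open import Function.Properties.Equivalence using () renaming (trans to ⇔-trans)
open import Relation.Binary using (Setoid)
open import Relation.Binary.Definitions using (_Respects_; tri<; tri≈; tri>)
open import Relation.Binary.PropositionalEquality as ≡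
  using (_≡_; _≢_; refl; _≗_; _→-setoid_; ≢-sym)
open import Relation.Nullary using (¬_; contradiction; Dec; yes; no; ofʸ; ofⁿ; invert; _×-dec_)
open import Relation.Nullary.Decidable using (⌊_⌋; toWitness; fromWitness)
open import Relation.Unary using (Pred; U; _⟨×⟩_)

open import Defs

private variable
  c₁ c₂ ℓ ℓ₁ ℓ₂ ℓ₃ ℓ₄ : Level

record Enumerates (S : Setoid c₁ ℓ) {p} (P : Pred (Setoid.Carrier S) p)
                  (xs : List (Setoid.Carrier S)) : Set (c₁ ⊔ ℓ ⊔ p) where
  open Membership S using (_∈_)
  field
    unique   : Unique S xs
    sound    : All P xs
    complete : ∀ {x} → P x → x ∈ xs

open Enumerates

unique⇒lookup-injective : ∀ (S : Setoid c₁ ℓ) {xs} → Unique S xs →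
                          ∀ {i j} → Setoid._≈_ S (lookup xs i) (lookup xs j) → i ≡ j
unique⇒lookup-injective S (x∉xs ∷ u) {Fin.zero}  {Fin.zero}  _  = refl
unique⇒lookup-injective S (x∉xs ∷ u) {Fin.zero}  {Fin.suc j} eq =
  contradiction eq (All.lookup x∉xs (Membershipₚ.∈-lookup j))
unique⇒lookup-injective S (x∉xs ∷ u) {Fin.suc i} {Fin.zero}  eq =
  contradiction (Setoid.sym S eq) (All.lookup x∉xs (Membershipₚ.∈-lookup i))
unique⇒lookup-injective S (x∉xs ∷ u) {Fin.suc i} {Fin.suc j} eq =
  ≡.cong Fin.suc (unique⇒lookup-injective S u eq)

-- Sending the i-th entry of xs to the position of its image in ys is an injection of index sets.
length-≤-by-retraction :
  ∀ {S : Setoid c₁ ℓ₁} {T : Setoid c₂ ℓ₂}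
    {P : Pred (Setoid.Carrier S) ℓ₃} {Q : Pred (Setoid.Carrier T) ℓ₄} {xs ys} → Enumerates S P xs → Enumerates T Q ys →
  (f : Setoid.Carrier S → Setoid.Carrier T) (g : Setoid.Carrier T → Setoid.Carrier S) →
  (∀ {x} → P x → Q (f x)) → Congruent (Setoid._≈_ T) (Setoid._≈_ S) g →
  (∀ {x} → P x → Setoid._≈_ S (g (f x)) x) →
  length xs ≤ length ys
length-≤-by-retraction {S = S} {T} {P} {xs = xs} {ys} EP EQ f g f-Q g-cong g∘f≈id =
  injective⇒≤ λ {i} {j} eq → unique⇒lookup-injective S (unique EP) (begin
    lookup xs i          ≈⟨ sym (g∘f≈id (P-at i)) ⟩
    g (f (lookup xs i))  ≈⟨ g-cong (index-injective T (image i) (image j) eq) ⟩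
    g (f (lookup xs j))  ≈⟨ g∘f≈id (P-at j) ⟩
    lookup xs j          ∎)
  where
  open Setoid S using (sym)
  open import Relation.Binary.Reasoning.Setoid S
  open Membership T using (_∈_)
  P-at : ∀ i → P (lookup xs i)
  P-at i = All.lookup (sound EP) (Membershipₚ.∈-lookup i)
  image : ∀ i → f (lookup xs i) ∈ ys
  image i = complete EQ (f-Q (P-at i))

cartesianProduct-enumerates :
  ∀ {S : Setoid c₁ ℓ₁} {T : Setoid c₂ ℓ₂}
    {P : Pred (Setoid.Carrier S) ℓ₃} {Q : Pred (Setoid.Carrier T) ℓ₄} {xs ys} → Enumerates S P xs → Enumerates T Q ys →
  Enumerates (S ×ₛ T) (P ⟨×⟩ Q) (cartesianProduct xs ys)
cartesianProduct-enumerates {S = S} {T} {xs = xs} {ys} EP EQ = record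
  { unique   = Unique.cartesianProduct⁺ S T (unique EP) (unique EQ)
  ; sound    = cartesianProduct⁺ (≡.setoid _) (≡.setoid _) xs ys
                 λ x∈xs y∈ys → All.lookup (sound EP) x∈xs , All.lookup (sound EQ) y∈ys
  ; complete = λ (Px , Qy) → ∈-cartesianProduct⁺ S T (complete EP Px) (complete EQ Qy)
  }

length-cartesianProduct : ∀ {A : Set c₁} {B : Set c₂} (xs : List A) (ys : List B) →
                          length (cartesianProduct xs ys) ≡ length xs * length ys
length-cartesianProduct []       ys = refl
length-cartesianProduct (x ∷ xs) ys = begin
  length (map (x ,_) ys ++ cartesianProduct xs ys)
    ≡⟨ length-++ (map (x ,_) ys) ⟩
  length (map (x ,_) ys) + length (cartesianProduct xs ys)
    ≡⟨ ≡.cong₂ _+_ (length-map (x ,_) ys) (length-cartesianProduct xs ys) ⟩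
  length ys + length xs * length ys
    ∎
  where open ≡.≡-Reasoning

upTo-enumerates : ∀ n → Enumerates (≡.setoid ℕ) (_< n) (upTo n)
upTo-enumerates n = record
  { unique   = Uniqueₚ.upTo⁺ n
  ; sound    = all-upTo n
  ; complete = Membershipₚ.∈-upTo⁺
  }

concatMap-map≡cartesianProductWith : ∀ {A B C : Set} (f : A → B → C) xs ys →
  concatMap (λ x → map (f x) ys) xs ≡ cartesianProductWith f xs ys
concatMap-map≡cartesianProductWith f []       ys = refl
concatMap-map≡cartesianProductWith f (x ∷ xs) ys =
  ≡.cong (map (f x) ys ++_) (concatMap-map≡cartesianProductWith f xs ys)

allWords′-enumerates : ∀ m n → Enumerates (Fin m →-setoid Fin n) U (allWords′ m n)
allWords′-enumerates zero    n = record
  { unique   = [] ∷ []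
  ; sound    = tt ∷ []
  ; complete = λ _ → here λ ()
  }
allWords′-enumerates (suc m) n =
  ≡.subst (Enumerates W U) (≡.sym (concatMap-map≡cartesianProductWith _ (allFin n) (allWords′ m n)))
    (record
      { unique   = Unique.cartesianProductWith⁺ (≡.setoid (Fin n)) W′ W _
                     (λ eq → eq Fin.zero , eq ∘ Fin.suc)
                     (Uniqueₚ.allFin⁺ n) (unique (allWords′-enumerates m n))
      ; sound    = All.universal (λ _ → tt) _
      ; complete = λ {w} _ → ∈-resp-≈ W (λ { Fin.zero → refl ; (Fin.suc i) → refl })
                     (∈-cartesianProductWith⁺ (≡.setoid (Fin n)) W′ W
                       (λ { x≡y v≗w Fin.zero → x≡y ; x≡y v≗w (Fin.suc i) → v≗w i })
                       (Membershipₚ.∈-allFin (w Fin.zero)) (complete (allWords′-enumerates m n) tt))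
      })
  where
  W W′ : Setoid 0ℓ 0ℓ
  W  = Fin (suc m) →-setoid Fin n
  W′ = Fin m →-setoid Fin n

-- Junk value 0 past the end: ⟦ w ⟧ below is meaningful on [0, n) only.
nth : List ℕ → ℕ → ℕ
nth []       _       = 0
nth (x ∷ xs) zero    = x
nth (x ∷ xs) (suc i) = nth xs i

⟦_⟧ : ∀ {n} → Word n → ℕ → ℕ
⟦ w ⟧ = nth (oneLine w)

EqualOn : ℕ → (ℕ → ℕ) → (ℕ → ℕ) → Set
EqualOn n F G = ∀ i → i < n → F i ≡ G i

MapsTo : ℕ → (ℕ → ℕ) → Set
MapsTo n F = ∀ i → i < n → F i < n

InjectiveOn : ℕ → (ℕ → ℕ) → Set
InjectiveOn n F = ∀ i j → i < n → j < n → F i ≡ F j → i ≡ j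

InvolutionOn : ℕ → (ℕ → ℕ) → Set
InvolutionOn n F = ∀ i → i < n → F (F i) ≡ i

nth-tabulate : ∀ {n} (f : Fin n → ℕ) i → nth (tabulate f) (toℕ i) ≡ f i
nth-tabulate f Fin.zero    = refl
nth-tabulate f (Fin.suc i) = nth-tabulate (f ∘ Fin.suc) i

⟦⟧-toℕ : ∀ {n} (w : Word n) i → ⟦ w ⟧ (toℕ i) ≡ toℕ (w i)
⟦⟧-toℕ w i = ≡.trans (≡.cong (λ L → nth L (toℕ i)) (map-tabulate (λ j → j) (toℕ ∘ w)))
                     (nth-tabulate (toℕ ∘ w) i)

⟦⟧-fromℕ< : ∀ {n} (w : Word n) {i} (i<n : i < n) → ⟦ w ⟧ i ≡ toℕ (w (fromℕ< i<n))
⟦⟧-fromℕ< w i<n = ≡.trans (≡.cong ⟦ w ⟧ (≡.sym (toℕ-fromℕ< i<n))) (⟦⟧-toℕ w (fromℕ< i<n))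

⟦⟧-maps : ∀ {n} (w : Word n) → MapsTo n ⟦ w ⟧
⟦⟧-maps w i i<n = ≡.subst (_< _) (≡.sym (⟦⟧-fromℕ< w i<n)) (toℕ<n _)

⟦⟧-cong : ∀ {n} {w v : Word n} → w ≗ v → ⟦ w ⟧ ≡ ⟦ v ⟧
⟦⟧-cong w≗v = ≡.cong nth (map-cong (≡.cong toℕ ∘ w≗v) (allFin _))

⟦square⟧ : ∀ {n} (w : Word n) → EqualOn n ⟦ square w ⟧ (⟦ w ⟧ ∘ ⟦ w ⟧)
⟦square⟧ {n} w i i<n = begin
  ⟦ square w ⟧ i      ≡⟨ ⟦⟧-fromℕ< (square w) i<n ⟩
  toℕ (w (w a))       ≡⟨ ⟦⟧-toℕ w (w a) ⟨
  ⟦ w ⟧ (toℕ (w a))   ≡⟨ ≡.cong ⟦ w ⟧ (⟦⟧-fromℕ< w i<n) ⟨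
  ⟦ w ⟧ (⟦ w ⟧ i)     ∎
  where
  open ≡.≡-Reasoning
  a : Fin n
  a = fromℕ< i<n

length-oneLine : ∀ {n} (w : Word n) → length (oneLine w) ≡ n
length-oneLine {n} w = ≡.trans (length-map (toℕ ∘ w) (allFin n)) (length-tabulate {n = n} (λ j → j))

fromℕ-or : ∀ {n} → Fin n → ℕ → Fin n
fromℕ-or {n} i v with v <? n
... | yes v<n = fromℕ< v<n
... | no  _   = i

toℕ-fromℕ-or : ∀ {n} (i : Fin n) {v} → v < n → toℕ (fromℕ-or i v) ≡ v
toℕ-fromℕ-or {n} i {v} v<n with v <? n
... | yes v<n′ = toℕ-fromℕ< v<n′
... | no  v≮n  = contradiction v<n v≮n

-- Abstract, so that type checking never unfolds a symbolic word to evaluate isPerm on it.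
abstract
  toWord : ∀ n → (ℕ → ℕ) → Word n
  toWord n F i = fromℕ-or i (F (toℕ i))

  toWord-cong : ∀ {n F G} → EqualOn n F G → toWord n F ≗ toWord n G
  toWord-cong F≗G i = ≡.cong (fromℕ-or i) (F≗G (toℕ i) (toℕ<n i))

  ⟦toWord⟧ : ∀ {n F} → MapsTo n F → EqualOn n F ⟦ toWord n F ⟧
  ⟦toWord⟧ {n} {F} F-maps i i<n = begin
    F i                            ≡⟨ ≡.cong F (toℕ-fromℕ< i<n) ⟨
    F (toℕ a)                      ≡⟨ toℕ-fromℕ-or a (F-maps (toℕ a) (toℕ<n a)) ⟨
    toℕ (fromℕ-or a (F (toℕ a)))   ≡⟨ ⟦⟧-fromℕ< (toWord n F) i<n ⟨
    ⟦ toWord n F ⟧ i               ∎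
    where
    open ≡.≡-Reasoning
    a : Fin n
    a = fromℕ< i<n

  toWord-⟦⟧ : ∀ {n} (w : Word n) → toWord n ⟦ w ⟧ ≗ w
  toWord-⟦⟧ w i = toℕ-injective
    (≡.trans (toℕ-fromℕ-or i (⟦⟧-maps w (toℕ i) (toℕ<n i))) (⟦⟧-toℕ w i))

EqualOn-∘ : ∀ {n F G} → EqualOn n F G → MapsTo n F → EqualOn n (F ∘ F) (G ∘ G)
EqualOn-∘ {G = G} F≗G F-maps i i<n = ≡.trans (F≗G _ (F-maps i i<n)) (≡.cong G (F≗G i i<n))

injectiveOn-cong : ∀ {n F G} → EqualOn n F G → InjectiveOn n F → InjectiveOn n G
injectiveOn-cong F≗G F-inj i j i<n j<n Gi≡Gj =
  F-inj i j i<n j<n (≡.trans (F≗G i i<n) (≡.trans Gi≡Gj (≡.sym (F≗G j j<n))))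

involutionOn-cong : ∀ {n F G} → EqualOn n F G → MapsTo n F → InvolutionOn n F → InvolutionOn n G
involutionOn-cong F≗G F-maps F-inv i i<n = ≡.trans (≡.sym (EqualOn-∘ F≗G F-maps i i<n)) (F-inv i i<n)

mapsTo-∘ : ∀ {n F G} → MapsTo n F → MapsTo n G → MapsTo n (F ∘ G)
mapsTo-∘ F-maps G-maps i i<n = F-maps _ (G-maps i i<n)

injectiveOn-∘ : ∀ {n F G} → InjectiveOn n F → MapsTo n G → InjectiveOn n G → InjectiveOn n (F ∘ G)
injectiveOn-∘ F-inj G-maps G-inj i j i<n j<n = G-inj i j i<n j<n ∘ F-inj _ _ (G-maps i i<n) (G-maps j j<n)

involutionOn⇒injectiveOn : ∀ {n F} → InvolutionOn n F → InjectiveOn n F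
involutionOn⇒injectiveOn {F = F} F-inv i j i<n j<n Fi≡Fj =
  ≡.trans (≡.sym (F-inv i i<n)) (≡.trans (≡.cong F Fi≡Fj) (F-inv j j<n))

injective⇒surjective : ∀ {n} {f : Fin n → Fin n} → Injective _≡_ _≡_ f → ∀ y → ∃[ x ] f x ≡ y
injective⇒surjective {suc n} {f} f-inj y with any? (λ x → f x Finₚ.≟ y)
... | yes found  = found
... | no  missed = contradiction (injective⇒≤ punched-injective) 1+n≰n
  where
  y≢f : ∀ x → y ≢ f x
  y≢f x y≡fx = missed (x , ≡.sym y≡fx)
  punched : Fin (suc n) → Fin n
  punched x = punchOut (y≢f x)
  punched-injective : Injective _≡_ _≡_ punched
  punched-injective {x₁} {x₂} eq = f-inj (punchOut-injective (y≢f x₁) (y≢f x₂) eq)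

injectiveOn⇒surjectiveOn : ∀ {n F} → MapsTo n F → InjectiveOn n F →
                           ∀ v → v < n → ∃[ u ] u < n × F u ≡ v
injectiveOn⇒surjectiveOn {n} {F} F-maps F-inj v v<n =
  toℕ u , toℕ<n u , ≡.trans (≡.sym (toℕ-f u)) (≡.trans (≡.cong toℕ fu≡v) (toℕ-fromℕ< v<n))
  where
  f : Fin n → Fin n
  f a = fromℕ< (F-maps (toℕ a) (toℕ<n a))
  toℕ-f : ∀ a → toℕ (f a) ≡ F (toℕ a)
  toℕ-f a = toℕ-fromℕ< (F-maps (toℕ a) (toℕ<n a))
  f-injective : Injective _≡_ _≡_ f
  f-injective {a} {b} fa≡fb = toℕ-injective (F-inj _ _ (toℕ<n a) (toℕ<n b)
    (≡.trans (≡.sym (toℕ-f a)) (≡.trans (≡.cong toℕ fa≡fb) (toℕ-f b))))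
  u : Fin n
  u = proj₁ (injective⇒surjective f-injective (fromℕ< v<n))
  fu≡v : f u ≡ fromℕ< v<n
  fu≡v = proj₂ (injective⇒surjective f-injective (fromℕ< v<n))

downward-induction : ∀ {ℓ} n (P : ℕ → Set ℓ) →
                     (∀ i → i < n → (∀ j → i < j → j < n → P j) → P i) → ∀ i → i < n → P i
downward-induction n P step i = go (n ∸ i) i ≤-refl
  where
  go : ∀ d i → n ∸ i ≤ d → i < n → P i
  go zero    i n-i≤0   i<n = contradiction (<-≤-trans (m<n⇒0<n∸m i<n) n-i≤0) (<-irrefl refl)
  go (suc d) i n-i≤d+1 i<n = step i i<n λ j i<j j<n →
    go d j (≤-pred (<-≤-trans (∸-monoʳ-< i<j (<⇒≤ j<n)) n-i≤d+1)) j<n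

T-all-allFin : ∀ {n} (f : Fin n → Bool) → T (and (map f (allFin n))) ⇔ (∀ i → T (f i))
T-all-allFin f = mk⇔
  (λ t i → All.lookup (all⁺ f _ t) (Membershipₚ.∈-allFin i))
  (λ h → all⁻ f (tabulate⁺ h))

T-implies : ∀ {A B : Set} (A? : Dec A) (B? : Dec B) → T (not ⌊ A? ⌋ ∨ ⌊ B? ⌋) ⇔ (A → B)
T-implies (yes a) (yes b) = mk⇔ (λ _ _ → b) (λ _ → tt)
T-implies (yes a) (no ¬b) = mk⇔ (λ ()) (λ a→b → ¬b (a→b a))
T-implies (no ¬a) B?      = mk⇔ (λ _ a → contradiction a ¬a) (λ _ → tt)

isPerm⇔injective : ∀ {n} (w : Word n) → T (isPerm w) ⇔ Injective _≡_ _≡_ w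
isPerm⇔injective w = mk⇔
  (λ t {i} {j} → Equivalence.to (T-implies (w i Finₚ.≟ w j) (i Finₚ.≟ j))
                   (Equivalence.to (T-all-allFin _) (Equivalence.to (T-all-allFin _) t i) j))
  (λ inj → Equivalence.from (T-all-allFin _) λ i → Equivalence.from (T-all-allFin _) λ j →
             Equivalence.from (T-implies (w i Finₚ.≟ w j) (i Finₚ.≟ j)) inj)

injective⇔injectiveOn : ∀ {n} (w : Word n) → Injective _≡_ _≡_ w ⇔ InjectiveOn n ⟦ w ⟧
injective⇔injectiveOn w = mk⇔
  (λ inj i j i<n j<n eq → begin
     i                  ≡⟨ toℕ-fromℕ< i<n ⟨
     toℕ (fromℕ< i<n)   ≡⟨ ≡.cong toℕ (inj (toℕ-injective (begin
                              toℕ (w (fromℕ< i<n))  ≡⟨ ⟦⟧-fromℕ< w i<n ⟨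
                              ⟦ w ⟧ i               ≡⟨ eq ⟩
                              ⟦ w ⟧ j               ≡⟨ ⟦⟧-fromℕ< w j<n ⟩
                              toℕ (w (fromℕ< j<n))  ∎))) ⟩
     toℕ (fromℕ< j<n)   ≡⟨ toℕ-fromℕ< j<n ⟩
     j                  ∎)
  (λ inj {a} {b} eq → toℕ-injective (inj (toℕ a) (toℕ b) (toℕ<n a) (toℕ<n b)
     (≡.trans (⟦⟧-toℕ w a) (≡.trans (≡.cong toℕ eq) (≡.sym (⟦⟧-toℕ w b))))))
  where open ≡.≡-Reasoning

isPerm⇔injectiveOn : ∀ {n} (w : Word n) → T (isPerm w) ⇔ InjectiveOn n ⟦ w ⟧
isPerm⇔injectiveOn w = ⇔-trans (isPerm⇔injective w) (injective⇔injectiveOn w)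

isInvolution : ∀ {n} → Word n → Bool
isInvolution {n} τ = and (map (λ i → square τ i ≡ᶠ i) (allFin n))

isInvolution⇔involutionOn : ∀ {n} (τ : Word n) → T (isInvolution τ) ⇔ InvolutionOn n ⟦ τ ⟧
isInvolution⇔involutionOn τ = mk⇔
  (λ t i i<n → let a = fromℕ< i<n in begin
     ⟦ τ ⟧ (⟦ τ ⟧ i)   ≡⟨ ⟦square⟧ τ i i<n ⟨
     ⟦ square τ ⟧ i    ≡⟨ ⟦⟧-fromℕ< (square τ) i<n ⟩
     toℕ (τ (τ a))     ≡⟨ ≡.cong toℕ (toWitness (Equivalence.to (T-all-allFin _) t a)) ⟩
     toℕ a             ≡⟨ toℕ-fromℕ< i<n ⟩
     i                 ∎)
  (λ inv → Equivalence.from (T-all-allFin _) λ a → fromWitness (toℕ-injective (begin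
     toℕ (τ (τ a))           ≡⟨ ⟦⟧-toℕ (square τ) a ⟨
     ⟦ square τ ⟧ (toℕ a)    ≡⟨ ⟦square⟧ τ (toℕ a) (toℕ<n a) ⟩
     ⟦ τ ⟧ (⟦ τ ⟧ (toℕ a))   ≡⟨ inv (toℕ a) (toℕ<n a) ⟩
     toℕ a                   ∎)))
  where open ≡.≡-Reasoning

Rising : ℕ → (ℕ → ℕ) → Set
Rising N s = ∀ i → suc i < N → s i ≤ s (suc i)

record OneDescent (N k : ℕ) (s : ℕ → ℕ) : Set where
  field
    position : ℕ
    in-range : suc position < N
    falls    : s (suc position) < s position
    size     : s position ∸ s (suc position) ≡ k
    rises    : ∀ i → suc i < N → i ≢ position → s i ≤ s (suc i)

open OneDescent

oneDescent-cong : ∀ {N k s t} → EqualOn N s t → OneDescent N k s → OneDescent N k t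
oneDescent-cong {N} {k} {s} {t} s≗t d = record
  { position = p
  ; in-range = in-range d
  ; falls    = ≡.subst₂ _<_ (s≗t (suc p) (in-range d)) (s≗t p p<N) (falls d)
  ; size     = ≡.trans (≡.sym (≡.cong₂ _∸_ (s≗t p p<N) (s≗t (suc p) (in-range d)))) (size d)
  ; rises    = λ i i+1<N i≢p → ≡.subst₂ _≤_ (s≗t i (<-trans (n<1+n i) i+1<N)) (s≗t (suc i) i+1<N)
                                 (rises d i i+1<N i≢p)
  }
  where
  p : ℕ
  p = position d
  p<N : p < N
  p<N = <-trans (n<1+n p) (in-range d)

oneDescent-bottom≡0 : ∀ {k t} → MapsTo (suc k) t → (d : OneDescent (suc k) k t) → t (suc (position d)) ≡ 0
oneDescent-bottom≡0 {k} {t} t-maps d = n≤0⇒n≡0 (+-cancelˡ-≤ k _ 0 (begin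
  k + t (suc q)                 ≡⟨ ≡.cong (_+ t (suc q)) (size d) ⟨
  t q ∸ t (suc q) + t (suc q)   ≡⟨ m∸n+n≡m (<⇒≤ (falls d)) ⟩
  t q                           ≤⟨ ≤-pred (t-maps q (<-trans (n<1+n q) (in-range d))) ⟩
  k                             ≡⟨ +-identityʳ k ⟨
  k + 0                         ∎))
  where
  open ≤-Reasoning
  q : ℕ
  q = position d

firstDescent : ℕ → (ℕ → ℕ) → ℕ
firstDescent zero    s = 0
firstDescent (suc N) s with s 1 <? s 0
... | yes _ = 0
... | no  _ = suc (firstDescent N (s ∘ suc))

descentBottom : ℕ → (ℕ → ℕ) → ℕ
descentBottom N s = s (suc (firstDescent N s))

firstDescent-unique : ∀ {N s} p → suc p < N → s (suc p) < s p → (∀ i → i < p → s i ≤ s (suc i)) →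
                      firstDescent N s ≡ p
firstDescent-unique {suc N} {s} zero    _           falls _ with s 1 <? s 0
... | yes _     = refl
... | no  s1≮s0 = contradiction falls s1≮s0
firstDescent-unique {suc N} {s} (suc p) (s≤s p+1<N) falls before with s 1 <? s 0
... | yes s1<s0 = contradiction (before 0 z<s) (<⇒≱ s1<s0)
... | no  _     = ≡.cong suc (firstDescent-unique p p+1<N falls (λ i i<p → before (suc i) (s≤s i<p)))

descentBottom-unique : ∀ {N k s} (d : OneDescent N k s) → descentBottom N s ≡ s (suc (position d))
descentBottom-unique {s = s} d = ≡.cong (s ∘ suc) (firstDescent-unique (position d) (in-range d) (falls d)
  (λ i i<p → rises d i (<-trans (s≤s i<p) (in-range d)) (<⇒≢ i<p)))

descentBottom-cong : ∀ {N k s t} → EqualOn N s t → OneDescent N k s → descentBottom N t ≡ descentBottom N s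
descentBottom-cong {N} {s = s} {t} s≗t d = begin
  descentBottom N t     ≡⟨ descentBottom-unique (oneDescent-cong s≗t d) ⟩
  t (suc (position d))  ≡⟨ s≗t _ (in-range d) ⟨
  s (suc (position d))  ≡⟨ descentBottom-unique d ⟨
  descentBottom N s     ∎
  where open ≡.≡-Reasoning

-- These lemmas take a nonempty list as head and tail: under the with-abstraction the
-- termination checker accepts recursion on y and ys, but not on y ∷ ys.
descentSizesL≡[]⇒rising : ∀ x L → descentSizesL (x ∷ L) ≡ [] → Rising (length (x ∷ L)) (nth (x ∷ L))
descentSizesL≡[]⇒rising x []       eq i (s≤s ())
descentSizesL≡[]⇒rising x (y ∷ ys) eq i i+1<N with y <ᵇ x | <ᵇ-reflects-< y x
descentSizesL≡[]⇒rising x (y ∷ ys) () i       i+1<N       | true  | _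
descentSizesL≡[]⇒rising x (y ∷ ys) eq zero    _           | false | ofⁿ y≮x = ≮⇒≥ y≮x
descentSizesL≡[]⇒rising x (y ∷ ys) eq (suc i) (s≤s i+1<N) | false | _       =
  descentSizesL≡[]⇒rising y ys eq i i+1<N

rising⇒descentSizesL≡[] : ∀ x L → Rising (length (x ∷ L)) (nth (x ∷ L)) → descentSizesL (x ∷ L) ≡ []
rising⇒descentSizesL≡[] x []       _ = refl
rising⇒descentSizesL≡[] x (y ∷ ys) r with y <ᵇ x | <ᵇ-reflects-< y x
... | true  | ofʸ y<x = contradiction (r 0 (s≤s (s≤s z≤n))) (<⇒≱ y<x)
... | false | _       = rising⇒descentSizesL≡[] y ys (λ i i+1<N → r (suc i) (s≤s i+1<N))

module _ {k : ℕ} where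

  oneDescent-∷ : ∀ {x} L → x ≤ nth L 0 → OneDescent (length L) k (nth L) →
                 OneDescent (suc (length L)) k (nth (x ∷ L))
  oneDescent-∷ L x≤y d = record
    { position = suc (position d)
    ; in-range = s≤s (in-range d)
    ; falls    = falls d
    ; size     = size d
    ; rises    = λ { zero    _           _   → x≤y
                   ; (suc i) (s≤s i+1<N) i≢p → rises d i i+1<N (i≢p ∘ ≡.cong suc) }
    }

  oneDescent-tail : ∀ {x} L (d : OneDescent (suc (length L)) k (nth (x ∷ L))) → ∀ {p} →
                    position d ≡ suc p → OneDescent (length L) k (nth L)
  oneDescent-tail L d refl = record
    { position = _
    ; in-range = ≤-pred (in-range d)
    ; falls    = falls d
    ; size     = size d
    ; rises    = λ i i+1<N i≢p → rises d (suc i) (s≤s i+1<N) (i≢p ∘ suc-injective)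
    }

  descentSizesL≡[k]⇒oneDescent : ∀ x L → descentSizesL (x ∷ L) ≡ k ∷ [] →
                                 OneDescent (length (x ∷ L)) k (nth (x ∷ L))
  descentSizesL≡[k]⇒oneDescent x (y ∷ ys) eq with y <ᵇ x | <ᵇ-reflects-< y x
  ... | true  | ofʸ y<x = record
    { position = 0
    ; in-range = s≤s (s≤s z≤n)
    ; falls    = y<x
    ; size     = ∷-injectiveˡ eq
    ; rises    = λ { zero    _           0≢0 → contradiction refl 0≢0
                   ; (suc i) (s≤s i+1<N) _   → descentSizesL≡[]⇒rising y ys (∷-injectiveʳ eq) i i+1<N }
    }
  ... | false | r = oneDescent-∷ (y ∷ ys) (≮⇒≥ (invert r)) (descentSizesL≡[k]⇒oneDescent y ys eq)

  oneDescent⇒descentSizesL≡[k] : ∀ x L → OneDescent (length (x ∷ L)) k (nth (x ∷ L)) →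
                                 descentSizesL (x ∷ L) ≡ k ∷ []
  oneDescent⇒descentSizesL≡[k] x [] d with in-range d
  ... | s≤s ()
  oneDescent⇒descentSizesL≡[k] x (y ∷ ys) d with y <ᵇ x | <ᵇ-reflects-< y x | position d in p≡
  ... | true  | ofʸ y<x | zero  = ≡.cong₂ _∷_
      (≡.subst (λ p → nth (x ∷ y ∷ ys) p ∸ nth (x ∷ y ∷ ys) (suc p) ≡ k) p≡ (size d))
      (rising⇒descentSizesL≡[] y ys λ i i+1<N →
         rises d (suc i) (s≤s i+1<N) (λ eq → 1+n≢0 (≡.trans eq p≡)))
  ... | true  | ofʸ y<x | suc p =
      contradiction (rises d 0 (s≤s (s≤s z≤n)) (λ eq → 1+n≢0 (≡.sym (≡.trans eq p≡)))) (<⇒≱ y<x)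
  ... | false | ofⁿ y≮x | zero  =
      contradiction (≡.subst (λ p → nth (x ∷ y ∷ ys) (suc p) < nth (x ∷ y ∷ ys) p) p≡ (falls d)) y≮x
  ... | false | ofⁿ y≮x | suc p = oneDescent⇒descentSizesL≡[k] y ys (oneDescent-tail (y ∷ ys) d p≡)

  descentSizesL≡[k]⇔oneDescent : ∀ L → descentSizesL L ≡ k ∷ [] ⇔ OneDescent (length L) k (nth L)
  descentSizesL≡[k]⇔oneDescent []      = mk⇔ (λ ()) (λ d → contradiction (in-range d) λ ())
  descentSizesL≡[k]⇔oneDescent (x ∷ L) =
    mk⇔ (descentSizesL≡[k]⇒oneDescent x L) (oneDescent⇒descentSizesL≡[k] x L)

oneDescentOfSize⇔ : ∀ {n} k (w : Word n) → T (oneDescentOfSize k w) ⇔ descentSizes n w ≡ k ∷ []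
oneDescentOfSize⇔ {n} k w with descentSizes n w
... | []        = mk⇔ (λ ()) (λ ())
... | d ∷ []    = mk⇔ (≡.cong (_∷ []) ∘ ≡ᵇ⇒≡ d k) (λ { refl → ≡⇒≡ᵇ k k refl })
... | _ ∷ _ ∷ _ = mk⇔ (λ ()) (λ ())

square-oneDescent⇔ : ∀ {n} k (w : Word n) →
                     T (oneDescentOfSize k (square w)) ⇔ OneDescent n k (⟦ w ⟧ ∘ ⟦ w ⟧)
square-oneDescent⇔ {n} k w = ⇔-trans (oneDescentOfSize⇔ k (square w)) (⇔-trans
  (descentSizesL≡[k]⇔oneDescent (oneLine (square w)))
  (mk⇔ (oneDescent-cong (⟦square⟧ w) ∘ ≡.subst OneDescentOfSquare (length-oneLine (square w)))
       (≡.subst OneDescentOfSquare (≡.sym (length-oneLine (square w)))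
         ∘ oneDescent-cong (λ i i<n → ≡.sym (⟦square⟧ w i i<n)))))
  where
  OneDescentOfSquare : ℕ → Set
  OneDescentOfSquare N = OneDescent N k ⟦ square w ⟧

module _ {n : ℕ} {F : ℕ → ℕ} (F-maps : MapsTo n F) where

  toWord-isPerm : InjectiveOn n F → T (isPerm (toWord n F))
  toWord-isPerm = Equivalence.from (isPerm⇔injectiveOn _) ∘ injectiveOn-cong (⟦toWord⟧ F-maps)

  toWord-isInvolution : InvolutionOn n F → T (isInvolution (toWord n F))
  toWord-isInvolution =
    Equivalence.from (isInvolution⇔involutionOn _) ∘ involutionOn-cong (⟦toWord⟧ F-maps) F-maps

  toWord-square-oneDescent : ∀ {k} → OneDescent n k (F ∘ F) → T (oneDescentOfSize k (square (toWord n F)))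
  toWord-square-oneDescent =
    Equivalence.from (square-oneDescent⇔ _ _) ∘ oneDescent-cong (EqualOn-∘ (⟦toWord⟧ F-maps) F-maps)

T-respects-≗ : ∀ {n} (p : Word n → Bool) (Sem : (ℕ → ℕ) → Set) →
               (∀ w → T (p w) ⇔ Sem ⟦ w ⟧) → (T ∘ p) Respects _≗_
T-respects-≗ p Sem p⇔Sem {w} {v} w≗v =
  Equivalence.from (p⇔Sem v) ∘ ≡.subst Sem (⟦⟧-cong w≗v) ∘ Equivalence.to (p⇔Sem w)

IsPermWith : ∀ {n} → (Word n → Bool) → Word n → Set
IsPermWith P w = T (isPerm w) × T (P w)

-- countPerms n P is length (permutations n P) by definition.
permutations : ∀ n → (Word n → Bool) → List (Word n)
permutations n P = filter (λ w → (isPerm w ∧ P w) Bool.≟ true) (allWords n)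

permutations-enumerate : ∀ n (P : Word n → Bool) → (T ∘ P) Respects _≗_ →
                         Enumerates (Fin n →-setoid Fin n) (IsPermWith P) (permutations n P)
permutations-enumerate n P P-resp = record
  { unique   = Unique.filter⁺ W accept? (unique all-words)
  ; sound    = All.map to-T (all-filter accept? (allWords n))
  ; complete = λ Pw → ∈-filter⁺ W accept? accept-resp (complete all-words tt) (from-T Pw)
  }
  where
  W : Setoid 0ℓ 0ℓ
  W = Fin n →-setoid Fin n
  all-words : Enumerates W U (allWords n)
  all-words = allWords′-enumerates n n
  accept? : ∀ w → Dec ((isPerm w ∧ P w) ≡ true)
  accept? w = (isPerm w ∧ P w) Bool.≟ true
  to-T : ∀ {w} → (isPerm w ∧ P w) ≡ true → IsPermWith P w
  to-T = Equivalence.to T-∧ ∘ Equivalence.from T-≡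
  from-T : ∀ {w} → IsPermWith P w → (isPerm w ∧ P w) ≡ true
  from-T = Equivalence.to T-≡ ∘ Equivalence.from T-∧
  accept-resp : (λ w → (isPerm w ∧ P w) ≡ true) Respects _≗_
  accept-resp w≗v =
    from-T ∘ Product.map (T-respects-≗ isPerm (InjectiveOn n) isPerm⇔injectiveOn w≗v) (P-resp w≗v) ∘ to-T

module Block (k : ℕ) where

  Inside : ℕ → ℕ → Set
  Inside x i = x ≤ i × i < x + suc k

  inside? : ∀ x i → Dec (Inside x i)
  inside? x i = x ≤? i ×-dec i <? x + suc k

  inside-+ : ∀ x {j} → j < suc k → Inside x (x + j)
  inside-+ x j<k+1 = m≤m+n x _ , +-monoʳ-< x j<k+1

  inside-offset : ∀ {x i} → Inside x i → i ∸ x < suc k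
  inside-offset {x} {i} (x≤i , i<x+k+1) = ≡.subst (i ∸ x <_) (m+n∸m≡n x (suc k)) (∸-monoˡ-< i<x+k+1 x≤i)

  inside-+∸ : ∀ {x i} → Inside x i → x + (i ∸ x) ≡ i
  inside-+∸ (x≤i , _) = m+[n∸m]≡n x≤i

  inside-suc-offset : ∀ {x i} → Inside x i → suc i ∸ x ≡ suc (i ∸ x)
  inside-suc-offset (x≤i , _) = +-∸-assoc 1 x≤i

  entering : ∀ {x i} → ¬ Inside x i → Inside x (suc i) → i < x
  entering {x} {i} i∉ (x≤i+1 , i+1<x+k+1) with x ≤? i
  ... | yes x≤i = contradiction (x≤i , <-trans (n<1+n i) i+1<x+k+1) i∉
  ... | no  x≰i = ≰⇒> x≰i

  above : ∀ {x i} → x ≤ i → ¬ Inside x i → x + suc k ≤ i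
  above {x} {i} x≤i i∉ with i <? x + suc k
  ... | yes i<x+k+1 = contradiction (x≤i , i<x+k+1) i∉
  ... | no  i≮x+k+1 = ≮⇒≥ i≮x+k+1

  leaving : ∀ {x i} → Inside x i → ¬ Inside x (suc i) → x + suc k ≤ suc i
  leaving (x≤i , _) = above (m≤n⇒m≤1+n x≤i)

  skip : ℕ → ℕ → ℕ
  skip x j with j <? x
  ... | yes _ = j
  ... | no  _ = j + suc k

  unskip : ℕ → ℕ → ℕ
  unskip x i with i <? x
  ... | yes _ = i
  ... | no  _ = i ∸ suc k

  skip-below : ∀ {x j} → j < x → skip x j ≡ j
  skip-below {x} {j} j<x with j <? x
  ... | yes _   = refl
  ... | no  j≮x = contradiction j<x j≮x

  skip-above : ∀ {x j} → x ≤ j → skip x j ≡ j + suc k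
  skip-above {x} {j} x≤j with j <? x
  ... | yes j<x = contradiction x≤j (<⇒≱ j<x)
  ... | no  _   = refl

  unskip-below : ∀ {x i} → i < x → unskip x i ≡ i
  unskip-below {x} {i} i<x with i <? x
  ... | yes _   = refl
  ... | no  i≮x = contradiction i<x i≮x

  unskip-above : ∀ {x i} → x ≤ i → unskip x i ≡ i ∸ suc k
  unskip-above {x} {i} x≤i with i <? x
  ... | yes i<x = contradiction x≤i (<⇒≱ i<x)
  ... | no  _   = refl

  skip-outside : ∀ x j → ¬ Inside x (skip x j)
  skip-outside x j with j <? x
  ... | yes j<x = λ (x≤j , _) → <⇒≱ j<x x≤j
  ... | no  j≮x = λ (_ , j+k+1<x+k+1) → <⇒≱ j+k+1<x+k+1 (+-monoˡ-≤ (suc k) (≮⇒≥ j≮x))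

  unskip-skip : ∀ x j → unskip x (skip x j) ≡ j
  unskip-skip x j with x ≤? j
  ... | no  x≰j = ≡.trans (≡.cong (unskip x) (skip-below (≰⇒> x≰j))) (unskip-below (≰⇒> x≰j))
  ... | yes x≤j = begin
    unskip x (skip x j)   ≡⟨ ≡.cong (unskip x) (skip-above x≤j) ⟩
    unskip x (j + suc k)  ≡⟨ unskip-above (≤-trans x≤j (m≤m+n j (suc k))) ⟩
    j + suc k ∸ suc k     ≡⟨ m+n∸n≡m j (suc k) ⟩
    j                     ∎
    where open ≡.≡-Reasoning

  skip-unskip : ∀ x i → ¬ Inside x i → skip x (unskip x i) ≡ i
  skip-unskip x i i∉ with x ≤? i
  ... | no  x≰i = ≡.trans (≡.cong (skip x) (unskip-below (≰⇒> x≰i))) (skip-below (≰⇒> x≰i))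
  ... | yes x≤i = begin
    skip x (unskip x i)    ≡⟨ ≡.cong (skip x) (unskip-above x≤i) ⟩
    skip x (i ∸ suc k)     ≡⟨ skip-above x≤i-k-1 ⟩
    i ∸ suc k + suc k      ≡⟨ m∸n+n≡m (≤-trans (m≤n+m (suc k) x) x+k+1≤i) ⟩
    i                      ∎
    where
    open ≡.≡-Reasoning
    x+k+1≤i : x + suc k ≤ i
    x+k+1≤i = above x≤i i∉
    x≤i-k-1 : x ≤ i ∸ suc k
    x≤i-k-1 = ≡.subst (_≤ i ∸ suc k) (m+n∸n≡m x (suc k)) (∸-monoˡ-≤ (suc k) x+k+1≤i)

  assemble : ℕ → (ℕ → ℕ) → (ℕ → ℕ) → ℕ → ℕ
  assemble x B T i with inside? x i
  ... | yes _ = x + B (i ∸ x)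
  ... | no  _ = skip x (T (unskip x i))

  blockPart : ℕ → (ℕ → ℕ) → ℕ → ℕ
  blockPart x P j = P (x + j) ∸ x

  outerPart : ℕ → (ℕ → ℕ) → ℕ → ℕ
  outerPart x P j = unskip x (P (skip x j))

  module AssembleAt (x : ℕ) (B T : ℕ → ℕ) where

    assemble-inside : ∀ {i} → Inside x i → assemble x B T i ≡ x + B (i ∸ x)
    assemble-inside {i} i∈ with inside? x i
    ... | yes _  = refl
    ... | no  i∉ = contradiction i∈ i∉

    assemble-outside : ∀ {i} → ¬ Inside x i → assemble x B T i ≡ skip x (T (unskip x i))
    assemble-outside {i} i∉ with inside? x i
    ... | yes i∈ = contradiction i∈ i∉
    ... | no  _  = refl

    assemble-+ : ∀ {j} → j < suc k → assemble x B T (x + j) ≡ x + B j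
    assemble-+ {j} j<k+1 = ≡.trans (assemble-inside (inside-+ x j<k+1)) (≡.cong (λ j → x + B j) (m+n∸m≡n x j))

    assemble-skip : ∀ j → assemble x B T (skip x j) ≡ skip x (T j)
    assemble-skip j = ≡.trans (assemble-outside (skip-outside x j)) (≡.cong (skip x ∘ T) (unskip-skip x j))

  record Inflation (n x : ℕ) (t s : ℕ → ℕ) : Set where
    field
      fits    : x + suc k ≤ n
      outside : ∀ i → i < n → ¬ Inside x i → s i ≡ i
      inside  : ∀ j → j < suc k → s (x + j) ≡ x + t j

  module _ {n x : ℕ} {t s : ℕ → ℕ} (I : Inflation n x t s) (t-maps : MapsTo (suc k) t) where
    open Inflation I

    inflation-inside : ∀ {i} → Inside x i → s i ≡ x + t (i ∸ x)
    inflation-inside i∈ = ≡.trans (≡.cong s (≡.sym (inside-+∸ i∈))) (inside _ (inside-offset i∈))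

    inflation-preserves-inside : ∀ {i} → Inside x i → Inside x (s i)
    inflation-preserves-inside i∈ = ≡.subst (Inside x) (≡.sym (inflation-inside i∈))
                                      (inside-+ x (t-maps _ (inside-offset i∈)))

    inflate : OneDescent (suc k) k t → OneDescent n k s
    inflate d = record
      { position = x + q
      ; in-range = ≡.subst (_< n) (+-suc x q) (≤-trans (+-monoʳ-< x (in-range d)) fits)
      ; falls    = ≡.subst₂ _<_ (≡.sym s[x+q+1]) (≡.sym s[x+q]) (+-monoʳ-< x (falls d))
      ; size     = ≡.trans (≡.cong₂ _∸_ s[x+q] s[x+q+1]) (≡.trans ([m+n]∸[m+o]≡n∸o x _ _) (size d))
      ; rises    = rises-s
      }
      where
      q : ℕ
      q = position d
      s[x+q] : s (x + q) ≡ x + t q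
      s[x+q] = inside q (<-trans (n<1+n q) (in-range d))
      s[x+q+1] : s (suc (x + q)) ≡ x + t (suc q)
      s[x+q+1] = ≡.trans (≡.cong s (≡.sym (+-suc x q))) (inside (suc q) (in-range d))
      rises-s : ∀ i → suc i < n → i ≢ x + q → s i ≤ s (suc i)
      rises-s i i+1<n i≢x+q with inside? x i | inside? x (suc i)
      ... | no i∉ | no i+1∉ = ≡.subst₂ _≤_ (≡.sym (outside i (<-trans (n<1+n i) i+1<n) i∉))
                                        (≡.sym (outside (suc i) i+1<n i+1∉)) (n≤1+n i)
      ... | no i∉ | yes i+1∈ = ≡.subst (_≤ s (suc i)) (≡.sym (outside i (<-trans (n<1+n i) i+1<n) i∉))
                                 (≤-trans (<⇒≤ (entering i∉ i+1∈)) (proj₁ (inflation-preserves-inside i+1∈)))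
      ... | yes i∈ | no i+1∉ = ≡.subst (s i ≤_) (≡.sym (outside (suc i) i+1<n i+1∉))
                                 (≤-trans (<⇒≤ (proj₂ (inflation-preserves-inside i∈))) (leaving i∈ i+1∉))
      ... | yes i∈ | yes i+1∈ = ≡.subst₂ _≤_ (≡.sym (inflation-inside i∈))
          (≡.sym (≡.trans (inflation-inside i+1∈) (≡.cong (λ a → x + t a) (inside-suc-offset i∈))))
          (+-monoʳ-≤ x (rises d (i ∸ x) (≡.subst (_< suc k) (inside-suc-offset i∈) (inside-offset i+1∈))
            (λ i-x≡q → i≢x+q (≡.trans (≡.sym (inside-+∸ i∈)) (≡.cong (x +_) i-x≡q)))))

    deflate : OneDescent n k s → OneDescent (suc k) k t
    deflate d = record
      { position = p ∸ x
      ; in-range = ≡.subst (_< suc k) (inside-suc-offset p∈) (inside-offset p+1∈)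
      ; falls    = +-cancelˡ-< x _ _ (≡.subst₂ _<_ s[p+1] s[p] (falls d))
      ; size     = ≡.trans (≡.sym ([m+n]∸[m+o]≡n∸o x _ _))
                           (≡.trans (≡.sym (≡.cong₂ _∸_ s[p] s[p+1])) (size d))
      ; rises    = λ j j+1<k+1 j≢p-x → +-cancelˡ-≤ x _ _ (≡.subst₂ _≤_
                     (inside j (<-trans (n<1+n j) j+1<k+1))
                     (≡.trans (≡.cong s (≡.sym (+-suc x j))) (inside (suc j) j+1<k+1))
                     (rises d (x + j) (≡.subst (_< n) (+-suc x j) (≤-trans (+-monoʳ-< x j+1<k+1) fits))
                       (λ x+j≡p → j≢p-x (≡.trans (≡.sym (m+n∸m≡n x j)) (≡.cong (_∸ x) x+j≡p)))))
      }
      where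
      p : ℕ
      p = position d
      p<n : p < n
      p<n = <-trans (n<1+n p) (in-range d)
      p∈ : Inside x p
      p∈ with inside? x p | inside? x (suc p)
      ... | yes p∈  | _         = p∈
      ... | no  p∉  | yes p+1∈  = contradiction (≤-<-trans (proj₁ (inflation-preserves-inside p+1∈))
                                    (≡.subst (s (suc p) <_) (outside p p<n p∉) (falls d)))
                                    (<-asym (entering p∉ p+1∈))
      ... | no  p∉  | no  p+1∉  = contradiction
                                    (≡.subst₂ _<_ (outside (suc p) (in-range d) p+1∉) (outside p p<n p∉) (falls d))
                                    (<-asym (n<1+n p))
      p+1∈ : Inside x (suc p)
      p+1∈ with inside? x (suc p)
      ... | yes p+1∈ = p+1∈
      ... | no  p+1∉ = contradiction (<-trans (falls d) (proj₂ (inflation-preserves-inside p∈)))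
          (≤⇒≯ (≡.subst (x + suc k ≤_) (≡.sym (outside (suc p) (in-range d) p+1∉)) (leaving p∈ p+1∉)))
      s[p] : s p ≡ x + t (p ∸ x)
      s[p] = inflation-inside p∈
      s[p+1] : s (suc p) ≡ x + t (suc (p ∸ x))
      s[p+1] = ≡.trans (inflation-inside p+1∈) (≡.cong (λ a → x + t a) (inside-suc-offset p∈))

  -- s increases on [0, p] and on [p + 1, n); the second run starts at bottom and the first ends at
  -- bottom + k.  By surjectivity the values below bottom open the first run and those above
  -- bottom + k close the second, so s fixes them.  A fixed point i inside the block would force s to
  -- fix bottom (if i ≤ p) or bottom + k (if p < i), values it already takes at p + 1 and at p.
  module OneDescentPermutation {n : ℕ} {s : ℕ → ℕ} (s-maps : MapsTo n s) (s-inj : InjectiveOn n s)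
                               (d : OneDescent n k s) where

    p : ℕ
    p = position d

    p<n : p < n
    p<n = <-trans (n<1+n p) (in-range d)

    bottom : ℕ
    bottom = s (suc p)

    top : s p ≡ bottom + k
    top = begin
      s p                         ≡⟨ m∸n+n≡m (<⇒≤ (falls d)) ⟨
      s p ∸ bottom + bottom       ≡⟨ ≡.cong (_+ bottom) (size d) ⟩
      k + bottom                  ≡⟨ +-comm k bottom ⟩
      bottom + k                  ∎
      where open ≡.≡-Reasoning

    bottom+k+1≤n : bottom + suc k ≤ n
    bottom+k+1≤n = ≡.subst (_≤ n) (≡.sym (+-suc bottom k)) (≡.subst (_< n) top (s-maps p p<n))

    surjective : ∀ v → v < n → ∃[ u ] u < n × s u ≡ v
    surjective = injectiveOn⇒surjectiveOn s-maps s-inj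

    rises-strictly : ∀ i → suc i < n → i ≢ p → s i < s (suc i)
    rises-strictly i i+1<n i≢p = ≤∧≢⇒< (rises d i i+1<n i≢p)
      (≢-sym 1+n≢n ∘ s-inj i (suc i) (<-trans (n<1+n i) i+1<n) i+1<n)

    NoDescentIn : ℕ → ℕ → Set
    NoDescentIn a b = b ≤ p ⊎ p < a

    -- s b ∸ s a ≥ b ∸ a, stated without truncated subtraction.
    ascent : ∀ {a b} → a ≤′ b → b < n → NoDescentIn a b → s a + b ≤ s b + a
    ascent ≤′-refl _ _ = ≤-refl
    ascent {a} (≤′-step {b} a≤′b) b+1<n no-desc′ = begin
      s a + suc b     ≡⟨ +-suc (s a) b ⟩
      suc (s a + b)   ≤⟨ s≤s (ascent a≤′b (<-trans (n<1+n b) b+1<n) no-desc) ⟩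
      suc (s b + a)   ≤⟨ +-monoˡ-≤ a (rises-strictly b b+1<n b≢p) ⟩
      s (suc b) + a   ∎
      where
      open ≤-Reasoning
      no-desc : NoDescentIn a b
      no-desc = Sum.map (≤-trans (n≤1+n b)) (λ p<a → p<a) no-desc′
      b≢p : b ≢ p
      b≢p = Sum.[ <⇒≢ , (λ p<a → ≢-sym (<⇒≢ (<-≤-trans p<a (≤′⇒≤ a≤′b)))) ] no-desc′

    ascent-≤ : ∀ {a b} → a ≤ b → b < n → NoDescentIn a b → s a ≤ s b
    ascent-≤ {a} {b} a≤b b<n no-desc =
      +-cancelʳ-≤ a _ _ (≤-trans (+-monoʳ-≤ (s a) a≤b) (ascent (≤⇒≤′ a≤b) b<n no-desc))

    ascent-< : ∀ {a b} → a < b → b < n → NoDescentIn a b → s a < s b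
    ascent-< {a} {b} a<b b<n no-desc = +-cancelʳ-≤ a _ _ (begin
      suc (s a) + a   ≡⟨ +-suc (s a) a ⟨
      s a + suc a     ≤⟨ +-monoʳ-≤ (s a) a<b ⟩
      s a + b         ≤⟨ ascent (≤⇒≤′ (<⇒≤ a<b)) b<n no-desc ⟩
      s b + a         ∎)
      where open ≤-Reasoning

    bottom<n : bottom < n
    bottom<n = ≤-trans (m<m+n bottom z<s) bottom+k+1≤n

    i≤s[i]-if-fixed-below : ∀ {i} → i < n → (∀ j → j < i → s j ≡ j) → i ≤ s i
    i≤s[i]-if-fixed-below {i} i<n below-fixed = ≮⇒≥ λ si<i →
      <⇒≢ si<i (s-inj (s i) i (s-maps i i<n) i<n (below-fixed (s i) si<i))

    fixes-below : ∀ i → i < bottom → s i ≡ i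
    fixes-below = <-rec (λ i → i < bottom → s i ≡ i) step
      where
      step : ∀ i → (∀ {j} → j < i → j < bottom → s j ≡ j) → i < bottom → s i ≡ i
      step i IH i<X with surjective i (<-trans i<X bottom<n)
      ... | q , q<n , sq≡i with suc p ≤? q
      ...   | yes p<q = contradiction (≡.subst (bottom ≤_) sq≡i (ascent-≤ p<q q<n (inj₂ ≤-refl))) (<⇒≱ i<X)
      ...   | no  p≮q with <-cmp q i
      ...     | tri< q<i _ _ = contradiction (≡.trans (≡.sym (IH q<i (<-trans q<i i<X))) sq≡i) (<⇒≢ q<i)
      ...     | tri≈ _ q≡i _ = ≡.subst (λ q → s q ≡ q) q≡i (≡.trans sq≡i (≡.sym q≡i))
      ...     | tri> _ _ i<q = contradiction
                                 (≡.subst (s i <_) sq≡i (ascent-< i<q q<n (inj₁ (≤-pred (≰⇒> p≮q)))))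
                                 (≤⇒≯ (i≤s[i]-if-fixed-below (<-trans i<q q<n) λ j j<i →
                                   IH j<i (<-trans j<i i<X)))

    s[i]≤i-if-fixed-above : ∀ {i} → i < n → (∀ j → i < j → j < n → s j ≡ j) → s i ≤ i
    s[i]≤i-if-fixed-above {i} i<n above-fixed = ≮⇒≥ λ i<si →
      <⇒≢ i<si (≡.sym (s-inj (s i) i (s-maps i i<n) i<n (above-fixed (s i) i<si (s-maps i i<n))))

    fixes-above : ∀ i → bottom + suc k ≤ i → i < n → s i ≡ i
    fixes-above i X+k+1≤i i<n = downward-induction n (λ i → bottom + suc k ≤ i → s i ≡ i) step i i<n X+k+1≤i
      where
      step : ∀ i → i < n → (∀ j → i < j → j < n → bottom + suc k ≤ j → s j ≡ j) →
             bottom + suc k ≤ i → s i ≡ i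
      step i i<n IH X+k+1≤i with surjective i i<n
      ... | q , q<n , sq≡i with suc p ≤? q
      ...   | no  p≮q = contradiction
                          (≡.subst₂ _≤_ sq≡i top (ascent-≤ (≤-pred (≰⇒> p≮q)) p<n (inj₁ ≤-refl)))
                          (<⇒≱ (≡.subst (_≤ i) (+-suc bottom k) X+k+1≤i))
      ...   | yes p<q with <-cmp q i
      ...     | tri> _ _ i<q = contradiction
                                 (≡.trans (≡.sym (IH q i<q q<n (≤-trans X+k+1≤i (<⇒≤ i<q)))) sq≡i)
                                 (≢-sym (<⇒≢ i<q))
      ...     | tri≈ _ q≡i _ = ≡.subst (λ q → s q ≡ q) q≡i (≡.trans sq≡i (≡.sym q≡i))
      ...     | tri< q<i _ _ = contradiction (≡.subst (_< s i) sq≡i (ascent-< q<i i<n (inj₂ p<q)))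
                                 (≤⇒≯ (s[i]≤i-if-fixed-above i<n λ j i<j j<n →
                                   IH j i<j j<n (≤-trans X+k+1≤i (<⇒≤ i<j))))

    fixes-outside : ∀ i → i < n → ¬ Inside bottom i → s i ≡ i
    fixes-outside i i<n i∉ with bottom ≤? i
    ... | no  X≰i = fixes-below i (≰⇒> X≰i)
    ... | yes X≤i = fixes-above i (above X≤i i∉) i<n

    moves-inside : ∀ {i} → Inside bottom i → s i ≢ i
    moves-inside {i} (X≤i , i<X+k+1) si≡i with i ≤? p
    ... | yes i≤p = <⇒≱ (s≤s i≤p) (≡.subst (_≤ i) (s-inj _ _ bottom<n (in-range d) sX≡X) X≤i)
      where
      open ≤-Reasoning
      sX≤X : s bottom ≤ bottom
      sX≤X = +-cancelʳ-≤ i _ _ (begin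
        s bottom + i   ≤⟨ ascent (≤⇒≤′ X≤i) (≤-<-trans i≤p p<n) (inj₁ i≤p) ⟩
        s i + bottom   ≡⟨ ≡.cong (_+ bottom) si≡i ⟩
        i + bottom     ≡⟨ +-comm i bottom ⟩
        bottom + i     ∎)
      sX≡X : s bottom ≡ bottom
      sX≡X = ≤-antisym sX≤X (i≤s[i]-if-fixed-below bottom<n fixes-below)
    ... | no  i≰p =
      <⇒≱ (≰⇒> i≰p) (≡.subst (i ≤_) (s-inj _ _ X+k<n p<n (≡.trans sY≡Y (≡.sym top))) i≤X+k)
      where
      open ≤-Reasoning
      i≤X+k : i ≤ bottom + k
      i≤X+k = ≤-pred (≡.subst (i <_) (+-suc bottom k) i<X+k+1)
      X+k<n : bottom + k < n
      X+k<n = ≡.subst (_≤ n) (+-suc bottom k) bottom+k+1≤n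
      Y≤sY : bottom + k ≤ s (bottom + k)
      Y≤sY = +-cancelʳ-≤ i _ _ (begin
        bottom + k + i     ≡⟨ +-comm (bottom + k) i ⟩
        i + (bottom + k)   ≡⟨ ≡.cong (_+ (bottom + k)) si≡i ⟨
        s i + (bottom + k) ≤⟨ ascent (≤⇒≤′ i≤X+k) X+k<n (inj₂ (≰⇒> i≰p)) ⟩
        s (bottom + k) + i ∎)
      sY≡Y : s (bottom + k) ≡ bottom + k
      sY≡Y = ≤-antisym (s[i]≤i-if-fixed-above X+k<n λ j X+k<j j<n →
               fixes-above j (≡.subst (_≤ j) (≡.sym (+-suc bottom k)) X+k<j) j<n) Y≤sY

  module Ambient (m : ℕ) where

    n : ℕ
    n = suc (k + m)

    m+k+1≡n : m + suc k ≡ n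
    m+k+1≡n = ≡.trans (+-suc m k) (≡.cong suc (+-comm m k))

    block-fits : ∀ {x} → x ≤ m → x + suc k ≤ n
    block-fits {x} x≤m = ≡.subst (x + suc k ≤_) m+k+1≡n (+-monoˡ-≤ (suc k) x≤m)

    block-fits⁻¹ : ∀ {x} → x + suc k ≤ n → x ≤ m
    block-fits⁻¹ {x} fits = +-cancelʳ-≤ (suc k) x m (≡.subst (x + suc k ≤_) (≡.sym m+k+1≡n) fits)

    inside-< : ∀ {x i} → x ≤ m → Inside x i → i < n
    inside-< x≤m (_ , i<x+k+1) = ≤-trans i<x+k+1 (block-fits x≤m)

    skip-< : ∀ {x j} → x ≤ m → j < m → skip x j < n
    skip-< {x} {j} x≤m j<m with x ≤? j
    ... | no  x≰j = ≡.subst (_< n) (≡.sym (skip-below (≰⇒> x≰j)))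
                      (≤-trans (<-trans (≰⇒> x≰j) (s≤s x≤m)) (s≤s (m≤n+m m k)))
    ... | yes x≤j = ≡.subst (_< n) (≡.sym (skip-above x≤j))
                      (≡.subst (j + suc k <_) m+k+1≡n (+-monoˡ-< (suc k) j<m))

    unskip-< : ∀ {x i} → x ≤ m → ¬ Inside x i → i < n → unskip x i < m
    unskip-< {x} {i} x≤m i∉ i<n with x ≤? i
    ... | no  x≰i = ≡.subst (_< m) (≡.sym (unskip-below (≰⇒> x≰i))) (<-≤-trans (≰⇒> x≰i) x≤m)
    ... | yes x≤i = ≡.subst (_< m) (≡.sym (unskip-above x≤i))
                      (≡.subst (i ∸ suc k <_) (m+n∸m≡n (suc k) m)
                        (∸-monoˡ-< i<n (≤-trans (m≤n+m (suc k) x) (above x≤i i∉))))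

    assemble-cong : ∀ {x B B′ T T′} → x ≤ m → EqualOn (suc k) B B′ → EqualOn m T T′ →
                    EqualOn n (assemble x B T) (assemble x B′ T′)
    assemble-cong {x} x≤m B≗B′ T≗T′ i i<n with inside? x i
    ... | yes i∈ = ≡.cong (x +_) (B≗B′ _ (inside-offset i∈))
    ... | no  i∉ = ≡.cong (skip x) (T≗T′ _ (unskip-< x≤m i∉ i<n))

    blockPart-cong : ∀ {x P Q} → x ≤ m → EqualOn n P Q → EqualOn (suc k) (blockPart x P) (blockPart x Q)
    blockPart-cong {x} x≤m P≗Q j j<k+1 = ≡.cong (_∸ x) (P≗Q _ (inside-< x≤m (inside-+ x j<k+1)))

    outerPart-cong : ∀ {x P Q} → x ≤ m → EqualOn n P Q → EqualOn m (outerPart x P) (outerPart x Q)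
    outerPart-cong {x} x≤m P≗Q j j<m = ≡.cong (unskip x) (P≗Q _ (skip-< x≤m j<m))

    module Assembly {x : ℕ} {B T : ℕ → ℕ} (x≤m : x ≤ m)
                    (B-maps : MapsTo (suc k) B) (B-inj : InjectiveOn (suc k) B) (B²-desc : OneDescent (suc k) k (B ∘ B))
                    (T-maps : MapsTo m T) (T-inv : InvolutionOn m T) where

      open AssembleAt x B T

      π : ℕ → ℕ
      π = assemble x B T

      π-maps : MapsTo n π
      π-maps i i<n with inside? x i
      ... | yes i∈ = inside-< x≤m (inside-+ x (B-maps _ (inside-offset i∈)))
      ... | no  i∉ = skip-< x≤m (T-maps _ (unskip-< x≤m i∉ i<n))

      π-inj : InjectiveOn n π
      π-inj i j i<n j<n with inside? x i | inside? x j
      ... | yes i∈ | yes j∈ = λ eq → begin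
        i              ≡⟨ inside-+∸ i∈ ⟨
        x + (i ∸ x)    ≡⟨ ≡.cong (x +_)
                            (B-inj _ _ (inside-offset i∈) (inside-offset j∈) (+-cancelˡ-≡ x _ _ eq)) ⟩
        x + (j ∸ x)    ≡⟨ inside-+∸ j∈ ⟩
        j              ∎
        where open ≡.≡-Reasoning
      ... | yes i∈ | no  j∉ = λ eq →
        contradiction (≡.subst (Inside x) eq (inside-+ x (B-maps _ (inside-offset i∈)))) (skip-outside x _)
      ... | no  i∉ | yes j∈ = λ eq →
        contradiction (≡.subst (Inside x) (≡.sym eq) (inside-+ x (B-maps _ (inside-offset j∈)))) (skip-outside x _)
      ... | no  i∉ | no  j∉ = λ eq → begin
        i                      ≡⟨ skip-unskip x i i∉ ⟨
        skip x (unskip x i)    ≡⟨ ≡.cong (skip x) (involutionOn⇒injectiveOn {F = T} T-inv _ _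
                                    (unskip-< x≤m i∉ i<n) (unskip-< x≤m j∉ j<n)
                                    (≡.trans (≡.sym (unskip-skip x _))
                                      (≡.trans (≡.cong (unskip x) eq) (unskip-skip x _)))) ⟩
        skip x (unskip x j)    ≡⟨ skip-unskip x j j∉ ⟩
        j                      ∎
        where open ≡.≡-Reasoning

      π²-outside : ∀ i → i < n → ¬ Inside x i → π (π i) ≡ i
      π²-outside i i<n i∉ = begin
        π (π i)                          ≡⟨ ≡.cong π (assemble-outside i∉) ⟩
        π (skip x (T (unskip x i)))      ≡⟨ assemble-skip (T (unskip x i)) ⟩
        skip x (T (T (unskip x i)))      ≡⟨ ≡.cong (skip x) (T-inv _ (unskip-< x≤m i∉ i<n)) ⟩
        skip x (unskip x i)              ≡⟨ skip-unskip x i i∉ ⟩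
        i                                ∎
        where open ≡.≡-Reasoning

      π²-inside : ∀ j → j < suc k → π (π (x + j)) ≡ x + B (B j)
      π²-inside j j<k+1 = ≡.trans (≡.cong π (assemble-+ j<k+1)) (assemble-+ (B-maps j j<k+1))

      π²-inflation : Inflation n x (B ∘ B) (π ∘ π)
      π²-inflation = record { fits = block-fits x≤m ; outside = π²-outside ; inside = π²-inside }

      π²-desc : OneDescent n k (π ∘ π)
      π²-desc = inflate π²-inflation (mapsTo-∘ B-maps B-maps) B²-desc

      π²-bottom : descentBottom n (π ∘ π) ≡ x
      π²-bottom = begin
        descentBottom n (π ∘ π)    ≡⟨ descentBottom-unique π²-desc ⟩
        π (π (suc (x + q)))        ≡⟨ ≡.cong (π ∘ π) (+-suc x q) ⟨
        π (π (x + suc q))          ≡⟨ π²-inside (suc q) (in-range B²-desc) ⟩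
        x + B (B (suc q))          ≡⟨ ≡.cong (x +_) (oneDescent-bottom≡0 (mapsTo-∘ B-maps B-maps) B²-desc) ⟩
        x + 0                      ≡⟨ +-identityʳ x ⟩
        x                          ∎
        where
        open ≡.≡-Reasoning
        q : ℕ
        q = position B²-desc

      blockPart-π : EqualOn (suc k) (blockPart x π) B
      blockPart-π j j<k+1 = ≡.trans (≡.cong (_∸ x) (assemble-+ j<k+1)) (m+n∸m≡n x (B j))

      outerPart-π : EqualOn m (outerPart x π) T
      outerPart-π j _ = ≡.trans (≡.cong (unskip x) (assemble-skip j)) (unskip-skip x (T j))

    module Disassembly {P : ℕ → ℕ} (P-maps : MapsTo n P) (P-inj : InjectiveOn n P)
                       (P²-desc : OneDescent n k (P ∘ P)) where

      open OneDescentPermutation (mapsTo-∘ P-maps P-maps) (injectiveOn-∘ P-inj P-maps P-inj) P²-desc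
        using (bottom; bottom+k+1≤n; fixes-outside; moves-inside) public

      bottom≤m : bottom ≤ m
      bottom≤m = block-fits⁻¹ bottom+k+1≤n

      P²-bottom : descentBottom n (P ∘ P) ≡ bottom
      P²-bottom = descentBottom-unique P²-desc

      -- P commutes with P ∘ P, so it preserves the fixed points of P ∘ P: the positions outside the block.
      P-outside : ∀ {i} → i < n → ¬ Inside bottom i → ¬ Inside bottom (P i)
      P-outside i<n i∉ Pi∈ = moves-inside Pi∈ (≡.cong P (fixes-outside _ i<n i∉))

      P-inside : ∀ {i} → Inside bottom i → Inside bottom (P i)
      P-inside {i} i∈ with inside? bottom (P i)
      ... | yes Pi∈ = Pi∈
      ... | no  Pi∉ = contradiction
        (P-inj _ _ (P-maps _ (P-maps i i<n)) i<n (fixes-outside (P i) (P-maps i i<n) Pi∉)) (moves-inside i∈)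
        where
        i<n : i < n
        i<n = inside-< bottom≤m i∈

      inner outer : ℕ → ℕ
      inner = blockPart bottom P
      outer = outerPart bottom P

      inner-maps : MapsTo (suc k) inner
      inner-maps j j<k+1 = inside-offset (P-inside (inside-+ bottom j<k+1))

      P-block : ∀ j → j < suc k → bottom + inner j ≡ P (bottom + j)
      P-block j j<k+1 = inside-+∸ (P-inside (inside-+ bottom j<k+1))

      inner-inj : InjectiveOn (suc k) inner
      inner-inj i j i<k+1 j<k+1 eq = +-cancelˡ-≡ bottom i j (P-inj _ _
        (inside-< bottom≤m (inside-+ bottom i<k+1)) (inside-< bottom≤m (inside-+ bottom j<k+1))
        (≡.trans (≡.sym (P-block i i<k+1)) (≡.trans (≡.cong (bottom +_) eq) (P-block j j<k+1))))

      P²-inflation : Inflation n bottom (inner ∘ inner) (P ∘ P)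
      P²-inflation = record
        { fits    = bottom+k+1≤n
        ; outside = fixes-outside
        ; inside  = λ j j<k+1 →
            ≡.trans (≡.cong P (≡.sym (P-block j j<k+1))) (≡.sym (P-block (inner j) (inner-maps j j<k+1)))
        }

      inner²-desc : OneDescent (suc k) k (inner ∘ inner)
      inner²-desc = deflate P²-inflation (mapsTo-∘ inner-maps inner-maps) P²-desc

      P-skip-outside : ∀ j → j < m → ¬ Inside bottom (P (skip bottom j))
      P-skip-outside j j<m = P-outside (skip-< bottom≤m j<m) (skip-outside bottom j)

      outer-maps : MapsTo m outer
      outer-maps j j<m = unskip-< bottom≤m (P-skip-outside j j<m) (P-maps _ (skip-< bottom≤m j<m))

      outer-inv : InvolutionOn m outer
      outer-inv j j<m = begin
        unskip bottom (P (skip bottom (unskip bottom (P (skip bottom j)))))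
          ≡⟨ ≡.cong (unskip bottom ∘ P) (skip-unskip bottom _ (P-skip-outside j j<m)) ⟩
        unskip bottom (P (P (skip bottom j)))
          ≡⟨ ≡.cong (unskip bottom) (fixes-outside _ (skip-< bottom≤m j<m) (skip-outside bottom j)) ⟩
        unskip bottom (skip bottom j)
          ≡⟨ unskip-skip bottom j ⟩
        j ∎
        where open ≡.≡-Reasoning

      reassemble : EqualOn n (assemble bottom inner outer) P
      reassemble i i<n with inside? bottom i
      ... | yes i∈ = ≡.trans (P-block _ (inside-offset i∈)) (≡.cong P (inside-+∸ i∈))
      ... | no  i∉ = ≡.trans (≡.cong (skip bottom ∘ unskip bottom ∘ P) (skip-unskip bottom i i∉))
                             (skip-unskip bottom (P i) (P-outside i<n i∉))

module Count (k m : ℕ) where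
  open Block k
  open Ambient m

  squareHasOneDescent : ∀ {N} → Word N → Bool
  squareHasOneDescent π = oneDescentOfSize k (square π)

  Decomposition : Set
  Decomposition = ℕ × Word (suc k) × Word m

  Decompositions : Setoid 0ℓ 0ℓ
  Decompositions = ≡.setoid ℕ ×ₛ ((Fin (suc k) →-setoid Fin (suc k)) ×ₛ (Fin m →-setoid Fin m))

  open Setoid Decompositions using (_≈_)

  IsDecomposition : Decomposition → Set
  IsDecomposition = (_< suc m) ⟨×⟩ (IsPermWith squareHasOneDescent ⟨×⟩ IsPermWith isInvolution)

  compose : Decomposition → Word n
  compose (x , β , τ) = toWord n (assemble x ⟦ β ⟧ ⟦ τ ⟧)

  decomposeAt : ℕ → (ℕ → ℕ) → Decomposition
  decomposeAt x P = x , toWord (suc k) (blockPart x P) , toWord m (outerPart x P)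

  decompose : Word n → Decomposition
  decompose π = decomposeAt (descentBottom n (⟦ π ⟧ ∘ ⟦ π ⟧)) ⟦ π ⟧

  decompose≡decomposeAt : ∀ {π x} → descentBottom n (⟦ π ⟧ ∘ ⟦ π ⟧) ≡ x →
                          decompose π ≡ decomposeAt x ⟦ π ⟧
  decompose≡decomposeAt {π} = ≡.cong (λ x → decomposeAt x ⟦ π ⟧)

  compose-cong : Congruent _≈_ _≗_ compose
  compose-cong {x , β , τ} {.x , β′ , τ′} (refl , β≗β′ , τ≗τ′) =
    ≡.cong-app (≡.cong₂ (λ B T → toWord n (assemble x B T)) (⟦⟧-cong β≗β′) (⟦⟧-cong τ≗τ′))

  decompose-cong : Congruent _≗_ _≈_ decompose
  decompose-cong π≗π′ =
    Setoid.reflexive Decompositions (≡.cong (λ P → decomposeAt (descentBottom n (P ∘ P)) P) (⟦⟧-cong π≗π′))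

  module Composed {x : ℕ} {β : Word (suc k)} {τ : Word m} (ok : IsDecomposition (x , β , τ)) where

    x≤m : x ≤ m
    x≤m = ≤-pred (proj₁ ok)

    open Assembly x≤m (⟦⟧-maps β) (Equivalence.to (isPerm⇔injectiveOn β) (proj₁ (proj₁ (proj₂ ok))))
      (Equivalence.to (square-oneDescent⇔ k β) (proj₂ (proj₁ (proj₂ ok))))
      (⟦⟧-maps τ) (Equivalence.to (isInvolution⇔involutionOn τ) (proj₂ (proj₂ (proj₂ ok))))
      public

    ⟦composed⟧ : EqualOn n π ⟦ compose (x , β , τ) ⟧
    ⟦composed⟧ = ⟦toWord⟧ π-maps

    composed-bottom : descentBottom n (⟦ compose (x , β , τ) ⟧ ∘ ⟦ compose (x , β , τ) ⟧) ≡ x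
    composed-bottom = ≡.trans
      (descentBottom-cong {n} {k} {π ∘ π} {⟦ compose (x , β , τ) ⟧ ∘ ⟦ compose (x , β , τ) ⟧}
        (EqualOn-∘ ⟦composed⟧ π-maps) π²-desc)
      π²-bottom

    composed-inner : EqualOn (suc k) (blockPart x ⟦ compose (x , β , τ) ⟧) ⟦ β ⟧
    composed-inner j j<k+1 = ≡.trans (≡.sym (blockPart-cong x≤m ⟦composed⟧ j j<k+1)) (blockPart-π j j<k+1)

    composed-outer : EqualOn m (outerPart x ⟦ compose (x , β , τ) ⟧) ⟦ τ ⟧
    composed-outer j j<m = ≡.trans (≡.sym (outerPart-cong x≤m ⟦composed⟧ j j<m)) (outerPart-π j j<m)

    decomposeAt-composed : decomposeAt x ⟦ compose (x , β , τ) ⟧ ≈ (x , β , τ)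
    decomposeAt-composed = refl
      , (λ j → ≡.trans (toWord-cong composed-inner j) (toWord-⟦⟧ β j))
      , (λ j → ≡.trans (toWord-cong composed-outer j) (toWord-⟦⟧ τ j))

  compose-sound : ∀ {d} → IsDecomposition d → IsPermWith squareHasOneDescent (compose d)
  compose-sound ok = toWord-isPerm π-maps π-inj , toWord-square-oneDescent π-maps π²-desc
    where open Composed ok

  -- Here and below the implicit arguments are spelled out: inferring them makes Agda
  -- evaluate the symbolic words, at a prohibitive cost.
  decompose-compose : ∀ {d} → IsDecomposition d → decompose (compose d) ≈ d
  decompose-compose {x , β , τ} ok = Setoid.trans Decompositions
    (Setoid.reflexive Decompositions (decompose≡decomposeAt {compose (x , β , τ)} {x} composed-bottom))
    decomposeAt-composed
    where open Composed ok

  module Decomposed {π : Word n} (ok : IsPermWith squareHasOneDescent π) where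

    open Disassembly (⟦⟧-maps π) (Equivalence.to (isPerm⇔injectiveOn π) (proj₁ ok))
      (Equivalence.to (square-oneDescent⇔ k π) (proj₂ ok)) public

    decompose≡decomposeAt-bottom : decompose π ≡ decomposeAt bottom ⟦ π ⟧
    decompose≡decomposeAt-bottom = decompose≡decomposeAt {π} {bottom} P²-bottom

    decomposeAt-bottom-ok : IsDecomposition (decomposeAt bottom ⟦ π ⟧)
    decomposeAt-bottom-ok = s≤s bottom≤m
      , (toWord-isPerm inner-maps inner-inj , toWord-square-oneDescent inner-maps inner²-desc)
      , (toWord-isPerm outer-maps (involutionOn⇒injectiveOn outer-inv) , toWord-isInvolution outer-maps outer-inv)

  decompose-sound : ∀ {π} → IsPermWith squareHasOneDescent π → IsDecomposition (decompose π)
  decompose-sound {π} ok = ≡.subst IsDecomposition {decomposeAt bottom ⟦ π ⟧} {decompose π}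
    (≡.sym decompose≡decomposeAt-bottom) decomposeAt-bottom-ok
    where open Decomposed ok

  compose-decompose : ∀ {π} → IsPermWith squareHasOneDescent π → compose (decompose π) ≗ π
  compose-decompose {π} ok i = begin
    compose (decompose π) i
      ≡⟨ ≡.cong (λ d → compose d i) decompose≡decomposeAt-bottom ⟩
    toWord n (assemble bottom ⟦ toWord (suc k) inner ⟧ ⟦ toWord m outer ⟧) i
      ≡⟨ toWord-cong (assemble-cong bottom≤m (λ j j<k+1 → ≡.sym (⟦toWord⟧ inner-maps j j<k+1))
                                             (λ j j<m → ≡.sym (⟦toWord⟧ outer-maps j j<m))) i ⟩
    toWord n (assemble bottom inner outer) i
      ≡⟨ toWord-cong reassemble i ⟩
    toWord n ⟦ π ⟧ i
      ≡⟨ toWord-⟦⟧ π i ⟩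
    π i
      ∎
    where
    open Decomposed ok
    open ≡.≡-Reasoning

  βs : List (Word (suc k))
  βs = permutations (suc k) squareHasOneDescent

  τs : List (Word m)
  τs = permutations m isInvolution

  decompositions : List Decomposition
  decompositions = cartesianProduct (upTo (suc m)) (cartesianProduct βs τs)

  squares-enumerate : ∀ N → Enumerates (Fin N →-setoid Fin N) (IsPermWith squareHasOneDescent)
                                       (permutations N squareHasOneDescent)
  squares-enumerate N = permutations-enumerate N squareHasOneDescent
    (T-respects-≗ squareHasOneDescent (λ F → OneDescent N k (F ∘ F)) (square-oneDescent⇔ k))

  decompositions-enumerate : Enumerates Decompositions IsDecomposition decompositions
  decompositions-enumerate = cartesianProduct-enumerates (upTo-enumerates (suc m))
    (cartesianProduct-enumerates (squares-enumerate (suc k))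
      (permutations-enumerate m isInvolution
        (T-respects-≗ isInvolution (InvolutionOn m) isInvolution⇔involutionOn)))

  count : countPerms n squareHasOneDescent ≡ suc m * b k * e m
  count = begin
    length (permutations n squareHasOneDescent)
      ≡⟨ ≤-antisym
           (length-≤-by-retraction (squares-enumerate n) decompositions-enumerate
              decompose compose decompose-sound compose-cong compose-decompose)
           (length-≤-by-retraction decompositions-enumerate (squares-enumerate n)
              compose decompose compose-sound decompose-cong decompose-compose) ⟩
    length decompositions
      ≡⟨ length-cartesianProduct (upTo (suc m)) (cartesianProduct βs τs) ⟩
    length (upTo (suc m)) * length (cartesianProduct βs τs)
      ≡⟨ ≡.cong₂ _*_ (length-upTo (suc m)) (length-cartesianProduct βs τs) ⟩
    suc m * (length βs * length τs)
      ≡⟨ *-assoc (suc m) (length βs) (length τs) ⟨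
    suc m * b k * e m
      ∎
    where open ≡.≡-Reasoning

-- The identity holds for every k ≤ n - 1.
theorem4p7 : (n k : ℕ) → 3 ≤ n → 2 ≤ k → k ≤ n ∸ 1 →
    countPerms n (λ π → oneDescentOfSize k (square π)) ≡ (n ∸ k) * b k * e (n ∸ k ∸ 1)
theorem4p7 (suc n) k _ _ k≤n with m , refl ← m≤n⇒∃[o]m+o≡n k≤n =
  ≡.trans (Count.count k m) (≡.cong (λ d → d * b k * e (d ∸ 1)) (≡.sym n+1-k≡m+1))
  where
  n+1-k≡m+1 : suc (k + m) ∸ k ≡ suc m
  n+1-k≡m+1 = ≡.trans (≡.cong (_∸ k) (≡.sym (+-suc k m))) (m+n∸m≡n k (suc m))
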